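{- Let $\mathcal{Z}$ be a zero-set and let $(\vec r,\vec c)$ be finitely supported enhancements such that the sequence $(r_j)$ takes $M$ distinct nonzero values and the sequence $(c_i)$ takes $N$ distinct nonzero values. If $(\vec r,\vec c)$ spans for $\mathcal{Z}$, then $\tau_{\mathrm{en}}(\mathcal{Z},\vec r,\vec c)\le M+N+1$.
   Context: $\mathbb{Z}_+=\{0,1,2,\dots\}$, $\mathbb{N}=\{1,2,\dots\}$. For $a,b\in\mathbb{N}$, $R_{a,b}=([0,a-1]\times[0,b-1])\cap\mathbb{Z}_+^2$; a zero-set is a union of $R_{a,b}$ over a finite $\mathcal{I}\subseteq\mathbb{N}^2$. For $x\in\mathbb{Z}_+^2$ and $A\subseteq\mathbb{Z}_+^2$, $\mathtt{row}(x,A)$ and $\mathtt{col}(x,A)$ are the numbers of points of $A$ on the horizontal and vertical line through $x$. Enhancements $\vec r=(r_0,r_1,\dots)$, $\vec c=(c_0,c_1,\dots)$ are weakly decreasing sequences of nonnegative integers; $\mathcal{T}_{\mathrm{en}}(A)=A\cup\{(i,j)\in\mathbb{Z}_+^2:(\mathtt{row}((i,j),A)+r_j,\mathtt{col}((i,j),A)+c_i)\notin\mathcal{Z}\}$; $(\vec r,\vec c)$ spans for $\mathcal{Z}$ if $\bigcup_{t\ge0}\mathcal{T}_{\mathrm{en}}^t(\emptyset)=\mathbb{Z}_+^2$; $\tau_{\mathrm{en}}(\mathcal{Z},\vec r,\vec c)=\inf\{t\in\mathbb{N}:\mathcal{T}_{\mathrm{en}}^t(\emptyset)=\mathbb{Z}_+^2\}$.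 -}

module Defs where

open import Level using (0ℓ)
open import Data.Nat using (ℕ; zero; suc; _+_; _∸_; _≤_; _<_; _≥_)
open import Data.Fin using (Fin)
open import Data.Product using (Σ; _×_; _,_; ∃; ∃-syntax)
open import Data.Sum using (_⊎_)
open import Data.Empty using (⊥)
open import Data.List using (List; length)
open import Data.List.Membership.Propositional using (_∈_)
open import Data.List.Relation.Unary.All using (All)
open import Data.List.Relation.Unary.Unique.Propositional using (Unique)
open import Relation.Nullary using (¬_)
open import Relation.Binary.PropositionalEquality using (_≡_; _≢_)
open import Function.Definitions using (Injective)
open import Function.Bundles using (_⇔_)

-- A point of ℤ₊² is a pair (i , j); i is the horizontal coordinate, j the vertical one.
-- Subsets of ℤ₊² (possibly infinite) are predicates.
PSet : Set₁
PSet = ℕ → ℕ → Set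

-- A zero-set is given by a finite index set 𝓘 ⊆ ℕ² (a list of pairs with entries ≥ 1);
-- 𝓩 = ⋃_{(a,b) ∈ 𝓘} R_{a,b},  R_{a,b} = [0,a-1] × [0,b-1].
IndexSet : Set
IndexSet = List (ℕ × ℕ)

ValidIndexSet : IndexSet → Set
ValidIndexSet I = All (λ { (a , b) → 1 ≤ a × 1 ≤ b }) I

InZ : IndexSet → ℕ → ℕ → Set
InZ I x y = ∃[ a ] ∃[ b ] ((a , b) ∈ I × x < a × y < b)

RowAtLeast : PSet → ℕ → ℕ → Set
RowAtLeast A k j = Σ (Fin k → ℕ) λ f → Injective _≡_ _≡_ f × (∀ m → A (f m) j)

ColAtLeast : PSet → ℕ → ℕ → Set
ColAtLeast A k i = Σ (Fin k → ℕ) λ f → Injective _≡_ _≡_ f × (∀ m → A i (f m))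

-- row((i,j),A) + r < a   (the row count may be infinite, in which case this is false);
-- equivalently: A does not have  a ∸ r  points on row j   (false when r ≥ a).
RowPlusLt : PSet → ℕ → ℕ → ℕ → Set
RowPlusLt A j r a = ¬ RowAtLeast A (a ∸ r) j

ColPlusLt : PSet → ℕ → ℕ → ℕ → Set
ColPlusLt A i c b = ¬ ColAtLeast A (b ∸ c) i

-- (row((i,j),A) + r_j , col((i,j),A) + c_i) ∈ 𝓩
EnhancedInZ : IndexSet → (ℕ → ℕ) → (ℕ → ℕ) → PSet → ℕ → ℕ → Set
EnhancedInZ I r c A i j =
  ∃[ a ] ∃[ b ] ((a , b) ∈ I × RowPlusLt A j (r j) a × ColPlusLt A i (c i) b)

Ten : IndexSet → (ℕ → ℕ) → (ℕ → ℕ) → PSet → PSet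
Ten I r c A i j = A i j ⊎ ¬ EnhancedInZ I r c A i j

EmptySet : PSet
EmptySet _ _ = ⊥

TenIter : IndexSet → (ℕ → ℕ) → (ℕ → ℕ) → ℕ → PSet
TenIter I r c zero    = EmptySet
TenIter I r c (suc t) = Ten I r c (TenIter I r c t)

WeaklyDecreasing : (ℕ → ℕ) → Set
WeaklyDecreasing r = ∀ m n → m ≤ n → r n ≤ r m

FinitelySupported : (ℕ → ℕ) → Set
FinitelySupported r = ∃[ n ] (∀ j → n ≤ j → r j ≡ 0)

NumDistinctNonzeroValues : (ℕ → ℕ) → ℕ → Set
NumDistinctNonzeroValues r M =
  Σ (List ℕ) λ l → Unique l × length l ≡ M ×
    (∀ v → (v ∈ l) ⇔ (v ≢ 0 × ∃[ j ] r j ≡ v))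

Spans : IndexSet → (ℕ → ℕ) → (ℕ → ℕ) → Set
Spans I r c = ∀ i j → ∃[ t ] TenIter I r c t i j

-- τ_en(𝓩, r, c) ≤ K,  τ_en = inf { t ∈ ℕ (t ≥ 1) : 𝓣_en^t(∅) = ℤ₊² }.
TauLe : IndexSet → (ℕ → ℕ) → (ℕ → ℕ) → ℕ → Set
TauLe I r c K = ∃[ t ] (1 ≤ t × t ≤ K × (∀ i j → TenIter I r c t i j))

module Submission where

-- Call  μ j  the number of distinct nonzero values of r strictly
-- above r j, and  ν i  the same for c.  We show that every point (i , j) that is
-- ever infected lies in  𝓣_en^(1 + μ j + ν i)(∅); since μ j ≤ M and ν i ≤ N,
-- spanning then gives 𝓣_en^(M+N+1)(∅) = ℤ₊².

open import Defs
open import Data.Nat using (ℕ; zero; suc; _+_; _∸_; _≤_; _<_; z≤n; s≤s; _<?_)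
open import Data.Nat.Properties
open import Data.Fin using (Fin; inject≤)
open import Data.Fin.Properties using (inject≤-injective)
open import Data.Product using (Σ; _×_; _,_)
open import Data.Sum using (inj₁; inj₂)
open import Data.Empty using (⊥; ⊥-elim)
open import Data.List using (List; []; _∷_; length)
open import Data.List.Membership.Propositional using (_∈_)
open import Data.List.Relation.Unary.Any using (here; there)
open import Relation.Nullary using (¬_; yes; no)
open import Relation.Binary.PropositionalEquality using (_≡_; refl; sym; subst)
open import Function.Definitions using (Injective)
open import Function.Bundles using (Equivalence)

-- At least k distinct naturals satisfy P.  RowAtLeast B k j is definitionally
-- ManyPoints (λ x → B x j) k, and likewise for columns.
ManyPoints : (ℕ → Set) → ℕ → Set
ManyPoints P k = Σ (Fin k → ℕ) λ f → Injective _≡_ _≡_ f × (∀ m → P (f m))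

manyPoints-weaken : ∀ {P k k'} → k' ≤ k → ManyPoints P k → ManyPoints P k'
manyPoints-weaken le (f , f-inj , f-P) =
  (λ m → f (inject≤ m le)) ,
  (λ eq → inject≤-injective le le _ _ (f-inj eq)) ,
  (λ m → f-P (inject≤ m le))

manyPoints-map : ∀ {P Q k} → (∀ x → P x → Q x) → ManyPoints P k → ManyPoints Q k
manyPoints-map g (f , f-inj , f-P) = f , f-inj , (λ m → g (f m) (f-P m))

countAbove : ℕ → List ℕ → ℕ
countAbove v [] = 0
countAbove v (w ∷ l) with v <? w
... | yes _ = suc (countAbove v l)
... | no _ = countAbove v l

countAbove-≤-length : ∀ v l → countAbove v l ≤ length l
countAbove-≤-length v [] = z≤n
countAbove-≤-length v (w ∷ l) with v <? w
... | yes _ = s≤s (countAbove-≤-length v l)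
... | no _ = m≤n⇒m≤1+n (countAbove-≤-length v l)

countAbove-antitone : ∀ {v v'} → v ≤ v' → ∀ l → countAbove v' l ≤ countAbove v l
countAbove-antitone le [] = z≤n
countAbove-antitone {v} {v'} le (w ∷ l) with v' <? w | v <? w
... | yes _ | yes _ = s≤s (countAbove-antitone le l)
... | yes v'<w | no v≮w = ⊥-elim (v≮w (≤-<-trans le v'<w))
... | no _ | yes _ = m≤n⇒m≤1+n (countAbove-antitone le l)
... | no _ | no _ = countAbove-antitone le l

-- If the larger threshold v' occurs in l, the count drops strictly: v' itself
-- is counted above v but not above v'.
countAbove-strict : ∀ {v v' l} → v < v' → v' ∈ l → countAbove v' l < countAbove v l
countAbove-strict {v} {v'} {.v' ∷ l} lt (here refl) with v' <? v' | v <? v'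
... | yes v'<v' | _ = ⊥-elim (<-irrefl refl v'<v')
... | no _ | yes _ = s≤s (countAbove-antitone (<⇒≤ lt) l)
... | no _ | no v≮v' = ⊥-elim (v≮v' lt)
countAbove-strict {v} {v'} {w ∷ l} lt (there v'∈l) with v' <? w | v <? w
... | yes _ | yes _ = s≤s (countAbove-strict lt v'∈l)
... | yes v'<w | no v≮w = ⊥-elim (v≮w (<-trans lt v'<w))
... | no _ | yes _ = m≤n⇒m≤1+n (countAbove-strict lt v'∈l)
... | no _ | no _ = countAbove-strict lt v'∈l

module Bootstrap (I : IndexSet) (r c : ℕ → ℕ) where

  A : ℕ → PSet
  A = TenIter I r c

  E : ℕ → ℕ → ℕ → Set
  E s = EnhancedInZ I r c (A s)

  enhancedInZ-transfer : ∀ {B C : PSet} {i j i' j'} →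
    r j ≤ r j' → c i ≤ c i' →
    (∀ x → B x j → C x j') → (∀ y → B i y → C i' y) →
    EnhancedInZ I r c C i' j' → EnhancedInZ I r c B i j
  enhancedInZ-transfer {B} {C} {i} {j} {i'} {j'} r≤ c≤ row⊆ col⊆ (a , b , ab∈I , rowFew , colFew) =
    a , b , ab∈I ,
    (λ many → rowFew (manyPoints-weaken {P = λ x → C x j'} (∸-monoʳ-≤ a r≤)
      (manyPoints-map {P = λ x → B x j} {Q = λ x → C x j'} row⊆ many))) ,
    (λ many → colFew (manyPoints-weaken {P = C i'} (∸-monoʳ-≤ b c≤)
      (manyPoints-map {P = B i} {Q = C i'} col⊆ many)))

  enhancedInZ-antitone : ∀ {B C : PSet} {i j} → (∀ x y → B x y → C x y) →
    EnhancedInZ I r c C i j → EnhancedInZ I r c B i j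
  enhancedInZ-antitone {B} {C} ⊆ = enhancedInZ-transfer {B} {C} ≤-refl ≤-refl (λ x → ⊆ x _) (λ y → ⊆ _ y)

  dominance : ∀ s {i j i' j'} → r j ≤ r j' → c i ≤ c i' → A s i j → A s i' j'
  dominance zero _ _ ()
  dominance (suc s) r≤ c≤ (inj₁ old) = inj₁ (dominance s r≤ c≤ old)
  dominance (suc s) r≤ c≤ (inj₂ notInZ) = inj₂ λ inZ → notInZ
    (enhancedInZ-transfer {A s} {A s} r≤ c≤ (λ x → dominance s r≤ ≤-refl) (λ y → dominance s ≤-refl c≤) inZ)

  grows : ∀ {s s' i j} → s ≤ s' → A s i j → A s' i j
  grows {s} {s'} le x = subst (λ t → A t _ _) (m∸n+n≡m le) (growsBy (s' ∸ s) x)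
    where
    growsBy : ∀ d {i j} → A s i j → A (d + s) i j
    growsBy zero x = x
    growsBy (suc d) x = inj₁ (growsBy d x)

  stable : ∀ s {i j} → A (suc s) i j → ¬ E s i j
  stable zero (inj₁ ())
  stable zero (inj₂ notInZ) = notInZ
  stable (suc s) (inj₁ old) inZ = stable s old (enhancedInZ-antitone {A s} {A (suc s)} (λ _ _ → inj₁) inZ)
  stable (suc s) (inj₂ notInZ) = notInZ

  module InfectionTime (μ ν : ℕ → ℕ)
    (μ-reverses : ∀ j j' → r j < r j' → μ j' < μ j)
    (ν-reverses : ∀ i i' → c i < c i' → ν i' < ν i) where

    infectedBy : ∀ t i j → A t i j → A (suc (μ j + ν i)) i j
    infectedBy zero i j ()
    infectedBy (suc t) i j (inj₁ old) = infectedBy t i j old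
    infectedBy (suc t) i j (inj₂ notInZ) = inj₂ λ inZ →
      notInZ (enhancedInZ-transfer {A t} {A s} ≤-refl ≤-refl (rowEarly inZ) (colEarly inZ) inZ)
      where
      s = μ j + ν i

      selfTooEarly : E s i j → ∀ {i' j'} → r j' ≤ r j → c i' ≤ c i → A t i' j' → ⊥
      selfTooEarly inZ r≤ c≤ a = stable s (infectedBy t i j (dominance t r≤ c≤ a)) inZ

      rowEarly : E s i j → ∀ x → A t x j → A s x j
      rowEarly inZ x ax with c i <? c x
      ... | yes lt = grows (≤-trans (≤-reflexive (sym (+-suc (μ j) (ν x))))
                                    (+-monoʳ-≤ (μ j) (ν-reverses i x lt)))
                           (infectedBy t x j ax)
      ... | no nlt = ⊥-elim (selfTooEarly inZ ≤-refl (≮⇒≥ nlt) ax)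

      colEarly : E s i j → ∀ y → A t i y → A s i y
      colEarly inZ y ay with r j <? r y
      ... | yes lt = grows (+-monoˡ-≤ (ν i) (μ-reverses j y lt)) (infectedBy t i y ay)
      ... | no nlt = ⊥-elim (selfTooEarly inZ (≮⇒≥ nlt) ≤-refl ay)

rank-reverses : ∀ (s : ℕ → ℕ) {M} ((l , _ , _ , l-spec) : NumDistinctNonzeroValues s M) →
  ∀ k k' → s k < s k' → countAbove (s k') l < countAbove (s k) l
rank-reverses s (l , _ , _ , l-spec) k k' lt =
  countAbove-strict lt (Equivalence.from (l-spec (s k'))
    ((λ eq → n≮0 (subst (s k <_) eq lt)) , k' , refl))

corollary2p5 : (I : IndexSet) → ValidIndexSet I →
    (r c : ℕ → ℕ) → WeaklyDecreasing r → WeaklyDecreasing c →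
    FinitelySupported r → FinitelySupported c →
    (M N : ℕ) → NumDistinctNonzeroValues r M → NumDistinctNonzeroValues c N →
    Spans I r c → TauLe I r c (M + N + 1)
corollary2p5 I _ r c _ _ _ _ M N rValues@(lr , _ , lr-length , _) cValues@(lc , _ , lc-length , _) spans =
  M + N + 1 , subst (1 ≤_) (+-comm 1 (M + N)) (s≤s z≤n) , ≤-refl , everywhere
  where
  open Bootstrap I r c
  μ ν : ℕ → ℕ
  μ j = countAbove (r j) lr
  ν i = countAbove (c i) lc
  open InfectionTime μ ν (rank-reverses r rValues) (rank-reverses c cValues)

  rankBound : ∀ i j → suc (μ j + ν i) ≤ M + N + 1
  rankBound i j = subst (suc (μ j + ν i) ≤_) (+-comm 1 (M + N))
    (s≤s (+-mono-≤ (subst (μ j ≤_) lr-length (countAbove-≤-length _ lr))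
                   (subst (ν i ≤_) lc-length (countAbove-≤-length _ lc))))

  everywhere : ∀ i j → A (M + N + 1) i j
  everywhere i j with spans i j
  ... | t , infected = grows (rankBound i j) (infectedBy t i j infected)
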